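{- Let $n\ge 1$ and $1\le k\le n$. Let $K$ denote Krattenthaler's bijection from $123$-avoiding permutations of $[n]$ to lattice paths from $(0,0)$ to $(n,n)$ with unit steps $E=(1,0)$ and $N=(0,1)$ never going above the line $y=x$, defined as follows: write $\pi=w_s m_s\cdots w_2 m_2 w_1 m_1$, where $m_s,\dots,m_1$ are the right-to-left maxima of $\pi$ read from left to right and $w_i$ is the (possibly empty) word immediately preceding $m_i$; reading $\pi$ from left to right starting at $(0,0)$, for each word $w_i$ append $|w_i|+1$ steps $E$, and for each $m_i$ append $m_i-m_{i-1}$ steps $N$ (with $m_0=0$). Then the set of paths $K(\pi)$, where $\pi$ ranges over $123$-avoiding permutations of $[n]$ with first ascent in position $k$, is in bijection with the set of lattice paths from $(k-1,0)$ to $(n-1,n-1)$ using steps $(1,0)$ and $(0,1)$ and never going above the line $y=x$. In particular both sets have cardinality $C_{n,k}=\frac{k}{2n-k}\binom{2n-k}{n}$.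
   Context: A permutation $\pi$ of $[n]$ is $123$-avoiding if there are no indices $a<b<c$ with $\pi(a)<\pi(b)<\pi(c)$. Its first ascent is in position $k$ if $k$ is the least index with $\pi(k)<\pi(k+1)$; by convention the decreasing permutation $n(n-1)\cdots1$ has first ascent in position $n$. An entry $\pi(j)$ is a right-to-left maximum if $\pi(j)>\pi(j')$ for all $j'>j$. The number of lattice paths from $(k-1,0)$ to $(n-1,n-1)$ with unit east/north steps staying weakly below $y=x$ is the Catalan convolution $C_{n,k}$. -}

module Defs where

open import Data.Nat using (ℕ; zero; suc; _+_; _*_; _∸_; _≤_; _<_; _<ᵇ_)
open import Data.Nat.Combinatorics using (_C_)
open import Data.Bool using (Bool; true; false; if_then_else_)
open import Data.List using (List; []; _∷_; _++_; length; replicate; reverse; map; upTo; [_])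
open import Data.List.Relation.Binary.Permutation.Propositional using (_↭_)
open import Data.List.Relation.Binary.Sublist.Propositional using (_⊆_)
open import Data.List.Relation.Unary.Unique.Propositional using (Unique)
open import Data.List.Membership.Propositional using (_∈_)
open import Data.Product using (Σ; ∃; _×_; _,_)
open import Data.Unit using (⊤)
open import Relation.Nullary using (¬_)
open import Relation.Binary.PropositionalEquality using (_≡_)
open import Function.Bundles using (_⇔_)

oneTo : ℕ → List ℕ
oneTo n = map suc (upTo n)

IsPerm : ℕ → List ℕ → Set
IsPerm n π = π ↭ oneTo n

Avoids123 : List ℕ → Set
Avoids123 π = ¬ (Σ ℕ λ a → Σ ℕ λ b → Σ ℕ λ c →
                   (a ∷ b ∷ c ∷ []) ⊆ π × a < b × b < c)

-- Position (1-based) of the first ascent: least k with π(k) < π(k+1);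
-- a decreasing list of length n (no ascent) gets n.
firstAscent : List ℕ → ℕ
firstAscent []            = 0
firstAscent (x ∷ [])      = 1
firstAscent (x ∷ y ∷ r)   = if x <ᵇ y then 1 else suc (firstAscent (y ∷ r))

data Step : Set where
  E N : Step

maxL : List ℕ → ℕ
maxL []      = 0
maxL (x ∷ r) = Data.Nat._⊔_ x (maxL r)

-- x is a right-to-left maximum iff it exceeds every later entry.
-- Decomposition π = w_s m_s ⋯ w_1 m_1 as the list of pairs (w_i , m_i),
-- read left to right; acc holds the reversed current word.
blocksAcc : List ℕ → List ℕ → List (List ℕ × ℕ)
blocksAcc acc []      = []
blocksAcc acc (x ∷ r) =
  if maxL r <ᵇ x then (reverse acc , x) ∷ blocksAcc [] r
                 else blocksAcc (x ∷ acc) r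

blocks : List ℕ → List (List ℕ × ℕ)
blocks = blocksAcc []

-- m_{i-1} for the next block to the right (m_0 = 0)
nextMax : List (List ℕ × ℕ) → ℕ
nextMax []             = 0
nextMax ((_ , m) ∷ _)  = m

pathOfBlocks : List (List ℕ × ℕ) → List Step
pathOfBlocks []              = []
pathOfBlocks ((w , m) ∷ bs)  =
  replicate (suc (length w)) E ++ replicate (m ∸ nextMax bs) N ++ pathOfBlocks bs

K : List ℕ → List Step
K π = pathOfBlocks (blocks π)

WeaklyBelow : ℕ → ℕ → List Step → Set
WeaklyBelow x y []      = y ≤ x
WeaklyBelow x y (E ∷ p) = y ≤ x × WeaklyBelow (suc x) y p
WeaklyBelow x y (N ∷ p) = y ≤ x × WeaklyBelow x (suc y) p

endPoint : ℕ → ℕ → List Step → ℕ × ℕ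
endPoint x y []      = x , y
endPoint x y (E ∷ p) = endPoint (suc x) y p
endPoint x y (N ∷ p) = endPoint x (suc y) p

BelowPath : ℕ × ℕ → ℕ × ℕ → List Step → Set
BelowPath (x₀ , y₀) q p = WeaklyBelow x₀ y₀ p × endPoint x₀ y₀ p ≡ q

KImage : ℕ → ℕ → List Step → Set
KImage n k p = Σ (List ℕ) λ π → IsPerm n π × Avoids123 π × firstAscent π ≡ k × K π ≡ p

TargetPaths : ℕ → ℕ → List Step → Set
TargetPaths n k = BelowPath (k ∸ 1 , 0) (n ∸ 1 , n ∸ 1)

Bij : {A B : Set} → (A → Set) → (B → Set) → Set
Bij {A} {B} P Q = Σ (A → B) λ f → Σ (B → A) λ g →
  (∀ a → P a → Q (f a)) × (∀ b → Q b → P (g b)) ×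
  (∀ a → P a → g (f a) ≡ a) × (∀ b → Q b → f (g b) ≡ b)

HasCard : {A : Set} → (A → Set) → ℕ → Set
HasCard {A} P c = Σ (List A) λ xs → Unique xs × (∀ a → (a ∈ xs) ⇔ P a) × length xs ≡ c

-- A 123-avoiding permutation is the union of two decreasing subsequences: its right-to-left
-- maxima m_s > ⋯ > m_1 and the remaining entries.  Hence π is determined by K(π), whose runs
-- E^(ℓ_i+1) N^(c_i+1) record the word lengths ℓ_i = |w_i| and the gaps c_i + 1 = m_i − m_(i−1).
-- K(π) stays weakly below y = x because the entries to the right of m_i are distinct values in
-- 1 … m_(i−1), hence at most m_(i−1) of them; conversely every such path is K(π) for the
-- permutation whose non-maxima are filled in decreasingly.  If K(π) = (EN)^i E^(ℓ+1) N r with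
-- ℓ ≥ 1, then π begins with i maxima followed by a decreasing word of length ℓ, so its first
-- ascent is k = i + ℓ (and (EN)^n has first ascent n).  Then (EN)^i E^(ℓ+1) N r ↦ N^i E r and
-- (EN)^n ↦ N^(n−1) is a bijection onto the paths from (k − 1, 0) to (n − 1, n − 1) weakly below
-- y = x.  These satisfy the ballot recursion, solved by the reflection principle as
-- C(2n−k−1, n−k) − C(2n−k−1, n), which absorption turns into (k / (2n − k)) C(2n − k, n).

module Submission where

open import Defs
open import Algebra.Properties.CommutativeSemigroup using (x∙yz≈y∙xz)
open import Data.Bool using (true; false)
open import Data.Empty using (⊥; ⊥-elim)
open import Data.List
  using (List; []; _∷_; _++_; length; replicate; map; drop; take; reverse; [_]; applyDownFrom; upTo)
open import Data.List.Membership.Propositional using (_∈_)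
open import Data.List.Membership.Propositional.Properties
  using (∈-map⁺; ∈-map⁻; ∈-++⁺ˡ; ∈-++⁺ʳ; ∈-++⁻; ∈-∃++; ∈-upTo⁺; ∈-upTo⁻)
open import Data.List.Properties
  using (length-map; length-++; length-take; length-drop; length-upTo; length-applyDownFrom; ∷-injectiveʳ;
         ++-identityʳ; ++-assoc; unfold-reverse; take++drop≡id; drop-[]; drop-drop; map-downFrom; reverse-upTo;
         reverse-map; map-∘; map-id-local)
open import Data.List.Relation.Binary.Permutation.Propositional
  using (_↭_; ↭-sym; ↭-trans; ↭-reflexive; prep; ↭⇒↭ₛ; module PermutationReasoning)
open import Data.List.Relation.Binary.Permutation.Propositional.Properties
  using (All-resp-↭; ∈-resp-↭; ↭-length; ↭-reverse; shift; shifts; ++⁺ˡ)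
open import Data.List.Relation.Binary.Sublist.Propositional using (_⊆_; []; _∷_; _∷ʳ_; from∈; minimum)
import Data.List.Relation.Binary.Sublist.Propositional.Properties as Sublist
open import Data.List.Relation.Ternary.Interleaving.Propositional using (Interleaving; []; consˡ; consʳ; toPermutation)
open import Data.List.Relation.Unary.All using (All; []; _∷_)
import Data.List.Relation.Unary.All as All
import Data.List.Relation.Unary.All.Properties as All
open import Data.List.Relation.Unary.AllPairs using (AllPairs; []; _∷_)
import Data.List.Relation.Unary.AllPairs as AllPairs
import Data.List.Relation.Unary.AllPairs.Properties as AllPairs
open import Data.List.Relation.Unary.Any using (here; there)
open import Data.List.Relation.Unary.Unique.Propositional using (Unique)
import Data.List.Relation.Unary.Unique.Propositional.Properties as Unique
open import Data.Nat using (ℕ; zero; suc; pred; _+_; _*_; _∸_; _≤_; _<_; _>_; _⊔_; _<ᵇ_; z≤n; s≤s; _≟_)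
open import Data.Nat.Combinatorics using (_C_; nCk+nC[k+1]≡[n+1]C[k+1]; nCk≡nC[n∸k]; nCn≡1; nC1≡n; k>n⇒nCk≡0)
open import Data.Nat.Properties
open import Data.Nat.Tactic.RingSolver using (solve-∀)
open import Data.Product using (Σ; _×_; _,_; proj₁; proj₂; map₁)
open import Data.Sum using (inj₁; inj₂)
open import Data.Unit using (⊤; tt)
open import Function using (_$_; _∘_)
open import Function.Bundles using (mk⇔; Equivalence)
open import Relation.Nullary using (¬_; yes; no)
open import Relation.Binary.PropositionalEquality
  using (_≡_; _≢_; refl; sym; trans; cong; cong₂; subst; setoid; module ≡-Reasoning)
open import Data.List.Relation.Binary.Permutation.Setoid.Properties (setoid ℕ) using (Unique-resp-↭)
open import Data.List.Membership.DecPropositional _≟_ using (_∈?_)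

#E #N : List Step → ℕ
#E []      = 0
#E (E ∷ p) = suc (#E p)
#E (N ∷ p) = #E p
#N []      = 0
#N (E ∷ p) = #N p
#N (N ∷ p) = suc (#N p)

Ballot : ℕ → List Step → Set
Ballot e       []      = ⊤
Ballot e       (E ∷ p) = Ballot (suc e) p
Ballot zero    (N ∷ p) = ⊥
Ballot (suc e) (N ∷ p) = Ballot e p

endPoint≡ : ∀ x y p → endPoint x y p ≡ (x + #E p , y + #N p)
endPoint≡ x y []      = cong₂ _,_ (sym (+-identityʳ x)) (sym (+-identityʳ y))
endPoint≡ x y (E ∷ p) = trans (endPoint≡ (suc x) y p) (cong (_, y + #N p) (sym (+-suc x (#E p))))
endPoint≡ x y (N ∷ p) = trans (endPoint≡ x (suc y) p) (cong (x + #E p ,_) (sym (+-suc y (#N p))))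

WeaklyBelow-head : ∀ {x y} p → WeaklyBelow x y p → y ≤ x
WeaklyBelow-head []      y≤x       = y≤x
WeaklyBelow-head (E ∷ p) (y≤x , _) = y≤x
WeaklyBelow-head (N ∷ p) (y≤x , _) = y≤x

WeaklyBelow⇒Ballot : ∀ y e p → WeaklyBelow (y + e) y p → Ballot e p
WeaklyBelow⇒Ballot y e       []      _       = tt
WeaklyBelow⇒Ballot y e       (E ∷ p) (_ , w) =
  WeaklyBelow⇒Ballot y (suc e) p (subst (λ x → WeaklyBelow x y p) (sym (+-suc y e)) w)
WeaklyBelow⇒Ballot y zero    (N ∷ p) (_ , w) =
  ⊥-elim (n≮n y (subst (suc y ≤_) (+-identityʳ y) (WeaklyBelow-head p w)))
WeaklyBelow⇒Ballot y (suc e) (N ∷ p) (_ , w) =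
  WeaklyBelow⇒Ballot (suc y) e p (subst (λ x → WeaklyBelow x (suc y) p) (+-suc y e) w)

Ballot⇒WeaklyBelow : ∀ y e p → Ballot e p → WeaklyBelow (y + e) y p
Ballot⇒WeaklyBelow y e       []      _ = m≤m+n y e
Ballot⇒WeaklyBelow y e       (E ∷ p) b =
  m≤m+n y e , subst (λ x → WeaklyBelow x y p) (+-suc y e) (Ballot⇒WeaklyBelow y (suc e) p b)
Ballot⇒WeaklyBelow y (suc e) (N ∷ p) b =
  m≤m+n y (suc e) , subst (λ x → WeaklyBelow x (suc y) p) (sym (+-suc y e)) (Ballot⇒WeaklyBelow (suc y) e p b)

#E-replicateE : ∀ a p → #E (replicate a E ++ p) ≡ a + #E p
#E-replicateE zero    p = refl
#E-replicateE (suc a) p = cong suc (#E-replicateE a p)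

#N-replicateE : ∀ a p → #N (replicate a E ++ p) ≡ #N p
#N-replicateE zero    p = refl
#N-replicateE (suc a) p = #N-replicateE a p

#E-replicateN : ∀ b p → #E (replicate b N ++ p) ≡ #E p
#E-replicateN zero    p = refl
#E-replicateN (suc b) p = #E-replicateN b p

#N-replicateN : ∀ b p → #N (replicate b N ++ p) ≡ b + #N p
#N-replicateN zero    p = refl
#N-replicateN (suc b) p = cong suc (#N-replicateN b p)

Ballot-replicateE⁺ : ∀ a {e} p → Ballot (e + a) p → Ballot e (replicate a E ++ p)
Ballot-replicateE⁺ zero    {e} p b = subst (λ e → Ballot e p) (+-identityʳ e) b
Ballot-replicateE⁺ (suc a) {e} p b = Ballot-replicateE⁺ a p (subst (λ e → Ballot e p) (+-suc e a) b)

Ballot-replicateN⁺ : ∀ b {e} p → b ≤ e → Ballot (e ∸ b) p → Ballot e (replicate b N ++ p)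
Ballot-replicateN⁺ zero    p _         bp = bp
Ballot-replicateN⁺ (suc b) p (s≤s b≤e) bp = Ballot-replicateN⁺ b p b≤e bp

-- Counting ballot paths

BallotPath : ℕ → ℕ → List Step → Set
BallotPath r d q = Ballot d q × #E q ≡ r × #N q ≡ d + r

ballotPaths : ℕ → ℕ → List (List Step)
ballotPaths zero    d       = replicate d N ∷ []
ballotPaths (suc r) zero    = map (E ∷_) (ballotPaths r 1)
ballotPaths (suc r) (suc d) = map (E ∷_) (ballotPaths r (suc (suc d))) ++ map (N ∷_) (ballotPaths (suc r) d)

∈-ballotPaths⁻ : ∀ r d {q} → q ∈ ballotPaths r d → BallotPath r d q
∈-ballotPaths⁻ zero    d (here refl) = subst (BallotPath 0 d) (++-identityʳ (replicate d N))
  (Ballot-replicateN⁺ d [] ≤-refl tt , #E-replicateN d [] , #N-replicateN d [])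
∈-ballotPaths⁻ (suc r) zero q∈ with ∈-map⁻ (E ∷_) q∈
... | q , q∈′ , refl with ∈-ballotPaths⁻ r 1 q∈′
...   | b , #Eq , #Nq = b , cong suc #Eq , #Nq
∈-ballotPaths⁻ (suc r) (suc d) q∈ with ∈-++⁻ (map (E ∷_) (ballotPaths r (suc (suc d)))) q∈
... | inj₁ q∈ᴱ with ∈-map⁻ (E ∷_) q∈ᴱ
...   | q , q∈′ , refl with ∈-ballotPaths⁻ r (suc (suc d)) q∈′
...     | b , #Eq , #Nq = b , cong suc #Eq , trans #Nq (cong suc (sym (+-suc d r)))
∈-ballotPaths⁻ (suc r) (suc d) q∈ | inj₂ q∈ᴺ with ∈-map⁻ (N ∷_) q∈ᴺ
...   | q , q∈′ , refl with ∈-ballotPaths⁻ (suc r) d q∈′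
...     | b , #Eq , #Nq = b , #Eq , cong suc #Nq

∈-ballotPaths⁺ : ∀ r d q → BallotPath r d q → q ∈ ballotPaths r d
∈-ballotPaths⁺ zero    zero    []      _                = here refl
∈-ballotPaths⁺ zero    (suc d) (N ∷ q) (b , #Eq , #Nq) with ∈-ballotPaths⁺ zero d q (b , #Eq , cong pred #Nq)
... | here refl = here refl
∈-ballotPaths⁺ (suc r) zero    (E ∷ q) (b , #Eq , #Nq) =
  ∈-map⁺ (E ∷_) (∈-ballotPaths⁺ r 1 q (b , cong pred #Eq , #Nq))
∈-ballotPaths⁺ (suc r) (suc d) (E ∷ q) (b , #Eq , #Nq) =
  ∈-++⁺ˡ (∈-map⁺ (E ∷_) (∈-ballotPaths⁺ r (suc (suc d)) q (b , cong pred #Eq , trans #Nq (cong suc (+-suc d r)))))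
∈-ballotPaths⁺ (suc r) (suc d) (N ∷ q) (b , #Eq , #Nq) =
  ∈-++⁺ʳ _ (∈-map⁺ (N ∷_) (∈-ballotPaths⁺ (suc r) d q (b , #Eq , cong pred #Nq)))
∈-ballotPaths⁺ zero    (suc d) []      (_ , _ , ())
∈-ballotPaths⁺ (suc r) d       []      (_ , () , _)
∈-ballotPaths⁺ zero    d       (E ∷ q) (_ , () , _)
∈-ballotPaths⁺ r       zero    (N ∷ q) (() , _)

ballotPaths-unique : ∀ r d → Unique (ballotPaths r d)
ballotPaths-unique zero    d       = All.[] ∷ []
ballotPaths-unique (suc r) zero    = Unique.map⁺ ∷-injectiveʳ (ballotPaths-unique r 1)
ballotPaths-unique (suc r) (suc d) =
  Unique.++⁺ (Unique.map⁺ ∷-injectiveʳ (ballotPaths-unique r (suc (suc d))))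
             (Unique.map⁺ ∷-injectiveʳ (ballotPaths-unique (suc r) d))
             E∷≢N∷
  where
  E∷≢N∷ : ∀ {q} → ¬ (q ∈ map (E ∷_) (ballotPaths r (suc (suc d))) × q ∈ map (N ∷_) (ballotPaths (suc r) d))
  E∷≢N∷ (q∈ᴱ , q∈ᴺ) with ∈-map⁻ (E ∷_) q∈ᴱ | ∈-map⁻ (N ∷_) q∈ᴺ
  ... | _ , _ , refl | _ , _ , ()

ballotNumber : ℕ → ℕ → ℕ
ballotNumber zero    d       = 1
ballotNumber (suc r) zero    = ballotNumber r 1
ballotNumber (suc r) (suc d) = ballotNumber r (suc (suc d)) + ballotNumber (suc r) d

length-ballotPaths : ∀ r d → length (ballotPaths r d) ≡ ballotNumber r d
length-ballotPaths zero    d       = refl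
length-ballotPaths (suc r) zero    = trans (length-map (E ∷_) (ballotPaths r 1)) (length-ballotPaths r 1)
length-ballotPaths (suc r) (suc d) = begin
  length (map (E ∷_) (ballotPaths r (suc (suc d))) ++ map (N ∷_) (ballotPaths (suc r) d))
    ≡⟨ length-++ (map (E ∷_) (ballotPaths r (suc (suc d)))) ⟩
  length (map (E ∷_) (ballotPaths r (suc (suc d)))) + length (map (N ∷_) (ballotPaths (suc r) d))
    ≡⟨ cong₂ _+_ (length-map (E ∷_) (ballotPaths r (suc (suc d)))) (length-map (N ∷_) (ballotPaths (suc r) d)) ⟩
  length (ballotPaths r (suc (suc d))) + length (ballotPaths (suc r) d)
    ≡⟨ cong₂ _+_ (length-ballotPaths r (suc (suc d))) (length-ballotPaths (suc r) d) ⟩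
  ballotNumber (suc r) (suc d) ∎
  where open ≡-Reasoning

nC0≡1 : ∀ n → n C 0 ≡ 1
nC0≡1 n = trans (nCk≡nC[n∸k] {k = 0} {n = n} z≤n) (nCn≡1 n)

[k+1]*[n+1]C[k+1]≡[n+1]*nCk : ∀ n k → suc k * (suc n C suc k) ≡ suc n * (n C k)
[k+1]*[n+1]C[k+1]≡[n+1]*nCk n zero = begin
  1 * (suc n C 1)  ≡⟨ *-identityˡ _ ⟩
  suc n C 1        ≡⟨ nC1≡n (suc n) ⟩
  suc n            ≡⟨ *-identityʳ (suc n) ⟨
  suc n * 1        ≡⟨ cong (suc n *_) (nC0≡1 n) ⟨
  suc n * (n C 0)  ∎
  where open ≡-Reasoning
[k+1]*[n+1]C[k+1]≡[n+1]*nCk zero (suc k) = begin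
  suc (suc k) * (1 C suc (suc k))  ≡⟨ cong (suc (suc k) *_) (k>n⇒nCk≡0 {1} {suc (suc k)} (s≤s (s≤s z≤n))) ⟩
  suc (suc k) * 0                  ≡⟨ *-zeroʳ (suc (suc k)) ⟩
  0                                ≡⟨ cong (1 *_) (k>n⇒nCk≡0 {0} {suc k} (s≤s z≤n)) ⟨
  1 * (0 C suc k)                  ∎
  where open ≡-Reasoning
[k+1]*[n+1]C[k+1]≡[n+1]*nCk (suc n) (suc k) = begin
  suc (suc k) * (suc (suc n) C suc (suc k))
    ≡⟨ cong (suc (suc k) *_) (nCk+nC[k+1]≡[n+1]C[k+1] (suc n) (suc k)) ⟨
  suc (suc k) * (X + suc n C suc (suc k))
    ≡⟨ *-distribˡ-+ (suc (suc k)) X _ ⟩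
  (X + suc k * X) + suc (suc k) * (suc n C suc (suc k))
    ≡⟨ cong₂ (λ a b → (X + a) + b) ([k+1]*[n+1]C[k+1]≡[n+1]*nCk n k) ([k+1]*[n+1]C[k+1]≡[n+1]*nCk n (suc k)) ⟩
  (X + suc n * (n C k)) + suc n * (n C suc k)
    ≡⟨ +-assoc X _ _ ⟩
  X + (suc n * (n C k) + suc n * (n C suc k))
    ≡⟨ cong (X +_) (*-distribˡ-+ (suc n) (n C k) (n C suc k)) ⟨
  X + suc n * (n C k + n C suc k)
    ≡⟨ cong (λ y → X + suc n * y) (nCk+nC[k+1]≡[n+1]C[k+1] n k) ⟩
  suc (suc n) * X ∎
  where
  open ≡-Reasoning
  X = suc n C suc k

-- M and L are kept abstract so that each recursive call only needs an arithmetic side condition.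
ballotNumber-reflection : ∀ r d {M L} → M ≡ r + r + d → L ≡ r + d → ballotNumber r d + M C suc L ≡ M C r
ballotNumber-reflection zero d {M} {L} refl refl = begin
  1 + d C suc d  ≡⟨ cong suc (k>n⇒nCk≡0 (n<1+n d)) ⟩
  1              ≡⟨ nC0≡1 d ⟨
  d C 0          ∎
  where open ≡-Reasoning
ballotNumber-reflection (suc r) zero {suc M} {suc L} M≡ L≡ = begin
  B + suc M C suc (suc L)               ≡⟨ cong (B +_) (nCk+nC[k+1]≡[n+1]C[k+1] M (suc L)) ⟨
  B + (M C suc L + M C suc (suc L))     ≡⟨ x∙yz≈y∙xz +-commutativeSemigroup B (M C suc L) _ ⟩
  M C suc L + (B + M C suc (suc L))     ≡⟨ cong₂ (λ l b → M C suc l + b) L≡r IH ⟩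
  M C suc r + M C r                     ≡⟨ +-comm (M C suc r) (M C r) ⟩
  M C r + M C suc r                     ≡⟨ nCk+nC[k+1]≡[n+1]C[k+1] M r ⟩
  suc M C suc r                         ∎
  where
  open ≡-Reasoning
  B = ballotNumber r 1
  L≡r : L ≡ r
  L≡r = trans (cong pred L≡) (+-identityʳ r)
  IH : B + M C suc (suc L) ≡ M C r
  IH = ballotNumber-reflection r 1 (trans (cong pred M≡) (rearrange r)) (trans L≡ (rearrange′ r))
    where
    rearrange : ∀ r → r + suc r + 0 ≡ r + r + 1
    rearrange = solve-∀
    rearrange′ : ∀ r → suc r + 0 ≡ r + 1
    rearrange′ = solve-∀
ballotNumber-reflection (suc r) (suc d) {suc M} {suc L} M≡ L≡ = begin
  (B₁ + B₂) + suc M C suc (suc L)             ≡⟨ cong (B₁ + B₂ +_) (nCk+nC[k+1]≡[n+1]C[k+1] M (suc L)) ⟨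
  (B₁ + B₂) + (M C suc L + M C suc (suc L))   ≡⟨ [x+y]+[z+w]≡[x+w]+[y+z] B₁ B₂ _ _ ⟩
  (B₁ + M C suc (suc L)) + (B₂ + M C suc L)   ≡⟨ cong₂ _+_ IH₁ IH₂ ⟩
  M C r + M C suc r                           ≡⟨ nCk+nC[k+1]≡[n+1]C[k+1] M r ⟩
  suc M C suc r                               ∎
  where
  open ≡-Reasoning
  B₁ = ballotNumber r (suc (suc d))
  B₂ = ballotNumber (suc r) d
  M≡′ : M ≡ r + suc r + suc d
  M≡′ = cong pred M≡
  IH₁ : B₁ + M C suc (suc L) ≡ M C r
  IH₁ = ballotNumber-reflection r (suc (suc d)) (trans M≡′ (rearrange r d)) (trans L≡ (rearrange′ r d))
    where
    rearrange : ∀ r d → r + suc r + suc d ≡ r + r + suc (suc d)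
    rearrange = solve-∀
    rearrange′ : ∀ r d → suc r + suc d ≡ r + suc (suc d)
    rearrange′ = solve-∀
  IH₂ : B₂ + M C suc L ≡ M C suc r
  IH₂ = ballotNumber-reflection (suc r) d (trans M≡′ (rearrange r d)) (trans (cong pred L≡) (rearrange′ r d))
    where
    rearrange : ∀ r d → r + suc r + suc d ≡ suc r + suc r + d
    rearrange = solve-∀
    rearrange′ : ∀ r d → r + suc d ≡ suc r + d
    rearrange′ = solve-∀
  [x+y]+[z+w]≡[x+w]+[y+z] : ∀ x y z w → (x + y) + (z + w) ≡ (x + w) + (y + z)
  [x+y]+[z+w]≡[x+w]+[y+z] = solve-∀
ballotNumber-reflection (suc r) zero    {zero}          () _
ballotNumber-reflection (suc r) (suc d) {zero}          () _
ballotNumber-reflection (suc r) zero    {suc M} {zero}  _ ()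
ballotNumber-reflection (suc r) (suc d) {suc M} {zero}  _ ()

ballotNumber-closedForm : ∀ r d → suc (r + r + d) * ballotNumber r d ≡ suc d * (suc (r + r + d) C suc (r + d))
ballotNumber-closedForm r d = +-cancelʳ-≡ (suc M * X) _ _ (begin
  suc M * B + suc M * X
    ≡⟨ cong (λ x → suc M * B + suc M * x) (nCk+nC[k+1]≡[n+1]C[k+1] M L) ⟨
  suc M * B + suc M * (M C L + M C suc L)
    ≡⟨ regroup (suc M) B (M C L) (M C suc L) ⟩
  suc M * (B + M C suc L) + suc M * (M C L)
    ≡⟨ cong (λ x → suc M * x + suc M * (M C L)) (trans (ballotNumber-reflection r d refl refl) MCr≡MCL) ⟩
  suc M * (M C L) + suc M * (M C L)
    ≡⟨ cong (λ x → x + x) ([k+1]*[n+1]C[k+1]≡[n+1]*nCk M L) ⟨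
  suc L * X + suc L * X
    ≡⟨ double r d X ⟩
  suc d * X + suc M * X ∎)
  where
  open ≡-Reasoning
  M = r + r + d
  L = r + d
  B = ballotNumber r d
  X = suc M C suc L
  MCr≡MCL : M C r ≡ M C L
  MCr≡MCL = trans (nCk≡nC[n∸k] (≤-trans (m≤m+n r r) (m≤m+n (r + r) d)))
                  (cong (M C_) (trans (cong (_∸ r) (+-assoc r r d)) (m+n∸m≡n r L)))
  regroup : ∀ a b y z → a * b + a * (y + z) ≡ a * (b + z) + a * y
  regroup = solve-∀
  double : ∀ r d x → suc (r + d) * x + suc (r + d) * x ≡ suc d * x + suc (r + r + d) * x
  double = solve-∀

-- Shapes of Dyck paths

Dyck : ℕ → List Step → Set
Dyck e p = Ballot e p × e + #E p ≡ #N p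

Shape : Set
Shape = List (ℕ × ℕ)

shapePath : Shape → List Step
shapePath []            = []
shapePath ((ℓ , c) ∷ S) = replicate (suc ℓ) E ++ replicate (suc c) N ++ shapePath S

shapeHeight : Shape → ℕ
shapeHeight []            = 0
shapeHeight ((ℓ , c) ∷ S) = suc (c + shapeHeight S)

shapeFirstAscent : Shape → ℕ
shapeFirstAscent []                = 0
shapeFirstAscent ((zero  , c) ∷ S) = suc (shapeFirstAscent S)
shapeFirstAscent ((suc ℓ , c) ∷ S) = suc ℓ

DyckShape : ℕ → Shape → Set
DyckShape e []            = e ≡ 0
DyckShape e ((ℓ , c) ∷ S) = c ≤ e + ℓ × DyckShape (e + ℓ ∸ c) S

#N-shapePath : ∀ S → #N (shapePath S) ≡ shapeHeight S
#N-shapePath []            = refl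
#N-shapePath ((ℓ , c) ∷ S) = begin
  #N (replicate (suc ℓ) E ++ replicate (suc c) N ++ shapePath S) ≡⟨ #N-replicateE (suc ℓ) _ ⟩
  #N (replicate (suc c) N ++ shapePath S)                         ≡⟨ #N-replicateN (suc c) (shapePath S) ⟩
  suc c + #N (shapePath S)                                        ≡⟨ cong (suc c +_) (#N-shapePath S) ⟩
  suc (c + shapeHeight S)                                         ∎
  where open ≡-Reasoning

DyckShape⇒Dyck : ∀ e S → DyckShape e S → Dyck e (shapePath S)
DyckShape⇒Dyck e []            e≡0         = tt , trans (+-identityʳ e) e≡0
DyckShape⇒Dyck e ((ℓ , c) ∷ S) (c≤ , dyck) = ballot , balance
  where
  p = shapePath S
  e′ = e + ℓ ∸ c
  IH = DyckShape⇒Dyck e′ S dyck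
  ballot : Ballot e (shapePath ((ℓ , c) ∷ S))
  ballot = Ballot-replicateE⁺ (suc ℓ) _
             (subst (λ x → Ballot x (replicate (suc c) N ++ p)) (sym (+-suc e ℓ))
                    (Ballot-replicateN⁺ (suc c) p (s≤s c≤) (proj₁ IH)))
  balance : e + #E (shapePath ((ℓ , c) ∷ S)) ≡ #N (shapePath ((ℓ , c) ∷ S))
  balance = begin
    e + #E (replicate (suc ℓ) E ++ replicate (suc c) N ++ p)
      ≡⟨ cong (e +_) (trans (#E-replicateE (suc ℓ) _) (cong (suc ℓ +_) (#E-replicateN (suc c) p))) ⟩
    e + (suc ℓ + #E p)        ≡⟨ trans (+-suc e _) (cong suc (sym (+-assoc e ℓ (#E p)))) ⟩
    suc ((e + ℓ) + #E p)      ≡⟨ cong (λ x → suc (x + #E p)) (m+[n∸m]≡n c≤) ⟨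
    suc ((c + e′) + #E p)     ≡⟨ cong suc (+-assoc c e′ (#E p)) ⟩
    suc (c + (e′ + #E p))     ≡⟨ cong (λ x → suc (c + x)) (proj₂ IH) ⟩
    suc (c + #N p)            ≡⟨ trans (#N-replicateE (suc ℓ) _) (#N-replicateN (suc c) p) ⟨
    #N (replicate (suc ℓ) E ++ replicate (suc c) N ++ p) ∎
    where open ≡-Reasoning

Dyck⇒shape : ∀ {e} p → Dyck e p →
  Σ ℕ λ b → Σ Shape λ S → replicate b N ++ shapePath S ≡ p × b ≤ e × DyckShape (e ∸ b) S
Dyck⇒shape {e} [] (_ , balance) = 0 , [] , refl , z≤n , trans (sym (+-identityʳ e)) balance
Dyck⇒shape {suc e} (N ∷ p) (ballot , balance) with Dyck⇒shape p (ballot , cong pred balance)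
... | b , S , path , b≤e , dyck = suc b , S , cong (N ∷_) path , s≤s b≤e , dyck
Dyck⇒shape {e} (E ∷ p) (ballot , balance) with Dyck⇒shape p (ballot , trans (sym (+-suc e (#E p))) balance)
... | suc c , S , path , s≤s c≤e , dyck =
  0 , (0 , c) ∷ S , cong (E ∷_) path , z≤n ,
  subst (c ≤_) (sym (+-identityʳ e)) c≤e , subst (λ x → DyckShape (x ∸ c) S) (sym (+-identityʳ e)) dyck
... | zero , (ℓ , c) ∷ S , path , _ , (c≤ , dyck) =
  0 , (suc ℓ , c) ∷ S , cong (E ∷_) path , z≤n ,
  subst (c ≤_) (sym (+-suc e ℓ)) c≤ , subst (λ x → DyckShape (x ∸ c) S) (sym (+-suc e ℓ)) dyck
... | zero , [] , refl , _ , _ = ⊥-elim (1+n≢0 (trans (sym (+-suc e 0)) balance))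

Dyck⇒shapeᴱ : ∀ {e} p → Dyck e (E ∷ p) → Σ Shape λ S → shapePath S ≡ E ∷ p × DyckShape e S
Dyck⇒shapeᴱ p dyck with Dyck⇒shape (E ∷ p) dyck
... | zero , S , path , _ , dyckS = S , path , dyckS
... | suc b , S , () , _ , _

toDyck : ℕ → List Step → List Step
toDyck j []      = replicate (suc j) E ++ N ∷ []
toDyck j (E ∷ q) = replicate (suc j) E ++ E ∷ N ∷ q
toDyck j (N ∷ q) = E ∷ N ∷ toDyck (pred j) q

deleteFirstN : List Step → List Step
deleteFirstN []      = []
deleteFirstN (E ∷ p) = E ∷ deleteFirstN p
deleteFirstN (N ∷ p) = p

fromDyck : ℕ → List Step → List Step
fromDyck (suc j) (E ∷ N ∷ p) = N ∷ fromDyck j p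
fromDyck j       p           = deleteFirstN (drop (suc j) p)

drop-replicate-++ : ∀ {A : Set} a (x : A) ys → drop a (replicate a x ++ ys) ≡ ys
drop-replicate-++ zero    x ys = refl
drop-replicate-++ (suc a) x ys = drop-replicate-++ a x ys

replicate-++-∷ : ∀ {A : Set} a (x : A) ys → replicate a x ++ x ∷ ys ≡ replicate (suc a) x ++ ys
replicate-++-∷ zero    x ys = refl
replicate-++-∷ (suc a) x ys = cong (x ∷_) (replicate-++-∷ a x ys)

replicateE-++-N-injective : ∀ a b {xs ys} → replicate a E ++ N ∷ xs ≡ replicate b E ++ N ∷ ys → a ≡ b
replicateE-++-N-injective zero    zero    eq = refl
replicateE-++-N-injective (suc a) (suc b) eq = cong suc (replicateE-++-N-injective a b (∷-injectiveʳ eq))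
replicateE-++-N-injective zero    (suc b) ()
replicateE-++-N-injective (suc a) zero    ()

fromDyck-toDyck : ∀ j q → Ballot j q → fromDyck j (toDyck j q) ≡ q
fromDyck-toDyck zero    []      _ = refl
fromDyck-toDyck (suc j) []      _ = cong deleteFirstN (drop-replicate-++ j E (N ∷ []))
fromDyck-toDyck zero    (E ∷ q) _ = refl
fromDyck-toDyck (suc j) (E ∷ q) _ = cong deleteFirstN (drop-replicate-++ j E (E ∷ N ∷ q))
fromDyck-toDyck (suc j) (N ∷ q) b = cong (N ∷_) (fromDyck-toDyck j q b)

#E-toDyck : ∀ j q → Ballot j q → #E (toDyck j q) ≡ suc j + #E q
#E-toDyck j       []      _ = #E-replicateE (suc j) (N ∷ [])
#E-toDyck j       (E ∷ q) _ = #E-replicateE (suc j) (E ∷ N ∷ q)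
#E-toDyck (suc j) (N ∷ q) b = cong suc (#E-toDyck j q b)

#N-toDyck : ∀ j q → Ballot j q → #N (toDyck j q) ≡ suc (#N q)
#N-toDyck j       []      _ = #N-replicateE (suc j) (N ∷ [])
#N-toDyck j       (E ∷ q) _ = #N-replicateE (suc j) (E ∷ N ∷ q)
#N-toDyck (suc j) (N ∷ q) b = cong suc (#N-toDyck j q b)

toDyck-shape : ∀ j q → Dyck j q →
  Σ Shape λ S → shapePath S ≡ toDyck j q × DyckShape 0 S × shapeFirstAscent S ≡ suc j
toDyck-shape zero    []      _ = (0 , 0) ∷ [] , refl , (z≤n , refl) , refl
toDyck-shape (suc j) []      (_ , ())
toDyck-shape (suc j) (N ∷ q) (ballot , balance) with toDyck-shape j q (ballot , cong pred balance)
... | S , path , dyck , fa = (0 , 0) ∷ S , cong (λ p → E ∷ N ∷ p) path , (z≤n , dyck) , cong suc fa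
toDyck-shape j       (E ∷ q) (ballot , balance) with Dyck⇒shapeᴱ (replicate j E ++ E ∷ N ∷ q) (ballotᴰ , balanceᴰ)
  where
  ballotᴰ : Ballot 1 (replicate j E ++ E ∷ N ∷ q)
  ballotᴰ = Ballot-replicateE⁺ j (E ∷ N ∷ q) ballot
  balanceᴰ : suc (#E (replicate j E ++ E ∷ N ∷ q)) ≡ #N (replicate j E ++ E ∷ N ∷ q)
  balanceᴰ = trans (cong suc (#E-replicateE j (E ∷ N ∷ q)))
                   (trans (cong suc balance) (sym (#N-replicateE j (E ∷ N ∷ q))))
... | (ℓ , c) ∷ S , path , dyck with replicateE-++-N-injective (suc ℓ) (suc (suc j))
                                      (trans path (replicate-++-∷ (suc j) E (N ∷ q)))
...   | refl = (suc j , c) ∷ S , path , dyck , refl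

shape-toDyck : ∀ j S → DyckShape 0 S → shapeFirstAscent S ≡ suc j →
  Σ (List Step) λ q → shapePath S ≡ toDyck j q × Ballot j q
shape-toDyck zero    ((zero , zero) ∷ [])               _            _  = [] , refl , tt
shape-toDyck (suc j) ((zero , zero) ∷ S@(_ ∷ _))        (_ , dyck)   fa with shape-toDyck j S dyck (cong pred fa)
... | q , path , ballot = N ∷ q , cong (λ p → E ∷ N ∷ p) path , ballot
shape-toDyck j       ((suc ℓ , d) ∷ S)                  (d≤ , dyck)  refl =
  E ∷ replicate d N ++ shapePath S ,
  sym (replicate-++-∷ (suc ℓ) E (replicate (suc d) N ++ shapePath S)) ,
  Ballot-replicateN⁺ d (shapePath S) d≤ (proj₁ (DyckShape⇒Dyck _ S dyck))
shape-toDyck zero    ((zero , zero) ∷ (zero , _) ∷ _)  _            ()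
shape-toDyck zero    ((zero , zero) ∷ (suc _ , _) ∷ _) _            ()
shape-toDyck (suc j) ((zero , zero) ∷ [])               _            ()

-- Decomposition at the right-to-left maxima

∈⇒≤maxL : ∀ {x xs} → x ∈ xs → x ≤ maxL xs
∈⇒≤maxL {x} {_ ∷ xs} (here refl) = m≤m⊔n x (maxL xs)
∈⇒≤maxL {x} {y ∷ xs} (there x∈) = ≤-trans (∈⇒≤maxL x∈) (m≤n⊔m y (maxL xs))

xs≤maxL : ∀ xs → All (_≤ maxL xs) xs
xs≤maxL xs = All.tabulate ∈⇒≤maxL

maxL≤ : ∀ {m xs} → All (_≤ m) xs → maxL xs ≤ m
maxL≤ []           = z≤n
maxL≤ (x≤m ∷ xs≤m) = ⊔-lub x≤m (maxL≤ xs≤m)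

maxL<  : ∀ {m xs} → 0 < m → All (_< m) xs → maxL xs < m
maxL< 0<m []           = 0<m
maxL< 0<m (x<m ∷ xs<m) = ⊔-lub x<m (maxL< 0<m xs<m)

maxL-++-∷ : ∀ w {m r} → All (_≤ m) w → maxL r < m → maxL (w ++ m ∷ r) ≡ m
maxL-++-∷ []      _            r<m = m≥n⇒m⊔n≡m (<⇒≤ r<m)
maxL-++-∷ (x ∷ w) (x≤m ∷ w≤m) r<m = trans (cong (x ⊔_) (maxL-++-∷ w w≤m r<m)) (m≤n⇒m⊔n≡n x≤m)

<⇒<ᵇ≡true : ∀ {m n} → m < n → (m <ᵇ n) ≡ true
<⇒<ᵇ≡true {m} {n} m<n with m <ᵇ n | <⇒<ᵇ m<n
... | true | _ = refl

≮⇒<ᵇ≡false : ∀ {m n} → ¬ m < n → (m <ᵇ n) ≡ false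
≮⇒<ᵇ≡false {m} {n} m≮n with m <ᵇ n | <ᵇ⇒< m n
... | false | _   = refl
... | true  | m<n = ⊥-elim (m≮n (m<n tt))

flatten : List (List ℕ × ℕ) → List ℕ
flatten []             = []
flatten ((w , m) ∷ bs) = w ++ m ∷ flatten bs

RLBlocks : List (List ℕ × ℕ) → Set
RLBlocks []             = ⊤
RLBlocks ((w , m) ∷ bs) = All (_≤ m) w × maxL (flatten bs) < m × RLBlocks bs

blocksAcc-max : ∀ acc x r → maxL r < x → blocksAcc acc (x ∷ r) ≡ (reverse acc , x) ∷ blocks r
blocksAcc-max acc x r r<x rewrite <⇒<ᵇ≡true r<x = refl

blocksAcc-nonmax : ∀ acc x r → x ≤ maxL r → blocksAcc acc (x ∷ r) ≡ blocksAcc (x ∷ acc) r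
blocksAcc-nonmax acc x r x≤r rewrite ≮⇒<ᵇ≡false (≤⇒≯ x≤r) = refl

reverse-∷-++ : ∀ (acc : List ℕ) x ys → reverse (x ∷ acc) ++ ys ≡ reverse acc ++ x ∷ ys
reverse-∷-++ acc x ys = trans (cong (_++ ys) (unfold-reverse x acc)) (++-assoc (reverse acc) [ x ] ys)

blocksAcc-flatten : ∀ acc w m bs → All (_≤ m) w → maxL (flatten bs) < m →
                    blocksAcc acc (w ++ m ∷ flatten bs) ≡ (reverse acc ++ w , m) ∷ blocks (flatten bs)
blocksAcc-flatten acc []      m bs _           r<m =
  trans (blocksAcc-max acc m (flatten bs) r<m) (cong (λ v → (v , m) ∷ _) (sym (++-identityʳ (reverse acc))))
blocksAcc-flatten acc (x ∷ w) m bs (x≤m ∷ w≤m) r<m = begin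
  blocksAcc acc (x ∷ w ++ m ∷ flatten bs)
    ≡⟨ blocksAcc-nonmax acc x (w ++ m ∷ flatten bs) (≤-trans x≤m (∈⇒≤maxL (∈-++⁺ʳ w (here refl)))) ⟩
  blocksAcc (x ∷ acc) (w ++ m ∷ flatten bs)
    ≡⟨ blocksAcc-flatten (x ∷ acc) w m bs w≤m r<m ⟩
  (reverse (x ∷ acc) ++ w , m) ∷ blocks (flatten bs)
    ≡⟨ cong (λ v → (v , m) ∷ _) (reverse-∷-++ acc x w) ⟩
  (reverse acc ++ x ∷ w , m) ∷ blocks (flatten bs) ∎
  where open ≡-Reasoning

blocks-flatten : ∀ bs → RLBlocks bs → blocks (flatten bs) ≡ bs
blocks-flatten []             _                  = refl
blocks-flatten ((w , m) ∷ bs) (w≤m , r<m , rlbs) =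
  trans (blocksAcc-flatten [] w m bs w≤m r<m) (cong ((w , m) ∷_) (blocks-flatten bs rlbs))

Decomposes : List ℕ → List (List ℕ × ℕ) → Set
Decomposes π bs = flatten bs ≡ π × RLBlocks bs

-- The pending entries acc are non-maxima, so they lie below the maximum of what remains.
blocksAcc-decomposition : ∀ acc π → All (0 <_) π → All (λ a → 0 < a × a ≤ maxL π) acc →
  Decomposes (reverse acc ++ π) (blocksAcc acc π)
blocksAcc-decomposition []      []      _ _                 = refl , tt
blocksAcc-decomposition (a ∷ _) []      _ ((0<a , a≤0) ∷ _) = ⊥-elim (<⇒≱ 0<a a≤0)
blocksAcc-decomposition acc     (x ∷ π) (0<x ∷ π>0) acc≤ with maxL π <? x
... | yes π<x = subst (Decomposes (reverse acc ++ x ∷ π)) (sym (blocksAcc-max acc x π π<x)) $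
  cong (λ r → reverse acc ++ x ∷ r) flat ,
  All-resp-↭ (↭-sym (↭-reverse acc)) (All.map (λ (_ , a≤) → subst (_ ≤_) x⊔π≡x a≤) acc≤) ,
  subst (λ r → maxL r < x) (sym flat) π<x , rl
  where
  x⊔π≡x : x ⊔ maxL π ≡ x
  x⊔π≡x = m≥n⇒m⊔n≡m (<⇒≤ π<x)
  IH = blocksAcc-decomposition [] π π>0 []
  flat = proj₁ IH
  rl = proj₂ IH
... | no π≮x = subst (Decomposes (reverse acc ++ x ∷ π)) (sym (blocksAcc-nonmax acc x π (≮⇒≥ π≮x))) $
  map₁ (λ flat → trans flat (reverse-∷-++ acc x π))
       (blocksAcc-decomposition (x ∷ acc) π π>0
          ((0<x , ≮⇒≥ π≮x) ∷ All.map (λ (0<a , a≤) → 0<a , subst (_ ≤_) x⊔π≡π a≤) acc≤))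
  where
  x⊔π≡π : x ⊔ maxL π ≡ maxL π
  x⊔π≡π = m≤n⇒m⊔n≡n (≮⇒≥ π≮x)

blocks-decomposition : ∀ π → All (0 <_) π → Decomposes π (blocks π)
blocks-decomposition π π>0 = blocksAcc-decomposition [] π π>0 []

Descending : List ℕ → Set
Descending = AllPairs _>_

shapeOf : List (List ℕ × ℕ) → Shape
shapeOf []             = []
shapeOf ((w , m) ∷ bs) = (length w , m ∸ suc (nextMax bs)) ∷ shapeOf bs

nextMax≡maxL : ∀ bs → RLBlocks bs → nextMax bs ≡ maxL (flatten bs)
nextMax≡maxL []             _                 = refl
nextMax≡maxL ((w , m) ∷ bs) (w≤m , r<m , _) = sym (maxL-++-∷ w w≤m r<m)

nextMax< : ∀ {w m} bs → RLBlocks ((w , m) ∷ bs) → nextMax bs < m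
nextMax< {m = m} bs (_ , r<m , rl) = subst (_< m) (sym (nextMax≡maxL bs rl)) r<m

∸-suc : ∀ {m n} → n < m → m ∸ n ≡ suc (m ∸ suc n)
∸-suc {suc m} (s≤s n≤m) = +-∸-assoc 1 n≤m

pathOfBlocks-shapeOf : ∀ bs → RLBlocks bs → pathOfBlocks bs ≡ shapePath (shapeOf bs)
pathOfBlocks-shapeOf []             _  = refl
pathOfBlocks-shapeOf ((w , m) ∷ bs) rl =
  cong₂ (λ c p → replicate (suc (length w)) E ++ replicate c N ++ p)
        (∸-suc (nextMax< bs rl)) (pathOfBlocks-shapeOf bs (proj₂ (proj₂ rl)))

shapeHeight-shapeOf : ∀ bs → RLBlocks bs → shapeHeight (shapeOf bs) ≡ nextMax bs
shapeHeight-shapeOf []             _  = refl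
shapeHeight-shapeOf ((w , m) ∷ bs) rl = begin
  suc ((m ∸ suc R) + shapeHeight (shapeOf bs))
    ≡⟨ cong (λ h → suc ((m ∸ suc R) + h)) (shapeHeight-shapeOf bs (proj₂ (proj₂ rl))) ⟩
  suc ((m ∸ suc R) + R)                         ≡⟨ +-suc (m ∸ suc R) R ⟨
  (m ∸ suc R) + suc R                           ≡⟨ m∸n+n≡m (nextMax< bs rl) ⟩
  m                                             ∎
  where
  open ≡-Reasoning
  R = nextMax bs

Unique⇒length≤ : ∀ M {xs} → Unique xs → All (0 <_) xs → All (_≤ M) xs → length xs ≤ M
Unique⇒length≤ zero    {[]}    _ _           _           = z≤n
Unique⇒length≤ zero    {x ∷ _} _ (0<x ∷ _)   (x≤0 ∷ _)   = ⊥-elim (<⇒≱ 0<x x≤0)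
Unique⇒length≤ (suc M) {xs}    u xs>0        xs≤         with suc M ∈? xs
... | no  M+1∉xs = m≤n⇒m≤1+n (Unique⇒length≤ M u xs>0 xs≤M)
  where
  xs≤M : All (_≤ M) xs
  xs≤M = All.zipWith (λ (x≤ , x≢) → ≤-pred (≤∧≢⇒< x≤ x≢))
           (xs≤ , All.tabulate (λ x∈ x≡ → M+1∉xs (subst (_∈ xs) x≡ x∈)))
... | yes M+1∈xs with ∈-∃++ M+1∈xs
...   | ys , zs , refl =
  subst (_≤ suc M) (sym (↭-length xs↭)) (s≤s (Unique⇒length≤ M u′ (All.map proj₁ rest) (All.map proj₂ rest)))
  where
  xs↭ : ys ++ suc M ∷ zs ↭ suc M ∷ ys ++ zs
  xs↭ = shift (suc M) ys zs
  u∷ : Unique (suc M ∷ ys ++ zs)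
  u∷ = Unique-resp-↭ (↭⇒↭ₛ xs↭) u
  u′ : Unique (ys ++ zs)
  u′ = AllPairs.tail u∷
  rest : All (λ x → 0 < x × x ≤ M) (ys ++ zs)
  rest = All.zipWith (λ ((0<x , x≤) , M+1≢x) → 0<x , ≤-pred (≤∧≢⇒< x≤ (M+1≢x ∘ sym)))
           (All.tail (All-resp-↭ xs↭ (All.zip (xs>0 , xs≤))) , AllPairs.head u∷)

Unique-++⁻ʳ : ∀ w {ys : List ℕ} → Unique (w ++ ys) → Unique ys
Unique-++⁻ʳ []      u       = u
Unique-++⁻ʳ (x ∷ w) (_ ∷ u) = Unique-++⁻ʳ w u

Unique-++-∷⇒≢ : ∀ w {m} {r : List ℕ} → Unique (w ++ m ∷ r) → All (_≢ m) w
Unique-++-∷⇒≢ []      _       = []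
Unique-++-∷⇒≢ (x ∷ w) (x≢ ∷ u) = All.lookup x≢ (∈-++⁺ʳ w (here refl)) ∷ Unique-++-∷⇒≢ w u

Avoids123-++⁻ʳ : ∀ w {ys} → Avoids123 (w ++ ys) → Avoids123 ys
Avoids123-++⁻ʳ w av (a , b , c , abc⊆ , a<b , b<c) = av (a , b , c , Sublist.++⁺ˡ w abc⊆ , a<b , b<c)

+-≤-cancel : ∀ {a ℓ c R} → a + ℓ ≡ c + R → ℓ ≤ R → c ≤ a × (a ∸ c) + ℓ ≡ R
+-≤-cancel {a} {ℓ} {c} {R} eq ℓ≤R with m≤n⇒∃[o]m+o≡n ℓ≤R
... | δ , refl = subst (c ≤_) (sym a≡c+δ) (m≤m+n c δ) ,
                 trans (cong (λ x → x ∸ c + ℓ) a≡c+δ) (trans (cong (_+ ℓ) (m+n∸m≡n c δ)) (+-comm δ ℓ))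
  where
  a≡c+δ : a ≡ c + δ
  a≡c+δ = +-cancelʳ-≡ ℓ a (c + δ) (trans eq (rearrange c ℓ δ))
    where
    rearrange : ∀ c ℓ δ → c + (ℓ + δ) ≡ c + δ + ℓ
    rearrange = solve-∀

shapeOf-Dyck : ∀ e bs → RLBlocks bs → Unique (flatten bs) → All (0 <_) (flatten bs) →
               e + length (flatten bs) ≡ nextMax bs → DyckShape e (shapeOf bs)
shapeOf-Dyck e []             _                    _ _   e+0≡0 = trans (sym (+-identityʳ e)) e+0≡0
shapeOf-Dyck e ((w , m) ∷ bs) rl@(_ , _ , rlbs) u pos e+len≡m =
  c≤a , shapeOf-Dyck (a ∸ c) bs rlbs uᵣ posᵣ a∸c+L≡R
  where
  r = flatten bs
  R = nextMax bs
  c = m ∸ suc R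
  a = e + length w
  uᵣ : Unique r
  uᵣ = AllPairs.tail (Unique-++⁻ʳ w u)
  posᵣ : All (0 <_) r
  posᵣ = All.tail (All.++⁻ʳ w pos)
  L≤R : length r ≤ R
  L≤R = Unique⇒length≤ R uᵣ posᵣ (subst (λ R → All (_≤ R) r) (sym (nextMax≡maxL bs rlbs)) (xs≤maxL r))
  a+L≡c+R : a + length r ≡ c + R
  a+L≡c+R = cong pred (begin
    suc (a + length r)             ≡⟨ +-suc a (length r) ⟨
    a + suc (length r)             ≡⟨ +-assoc e (length w) _ ⟩
    e + (length w + suc (length r)) ≡⟨ cong (e +_) (length-++ w) ⟨
    e + length (w ++ m ∷ r)        ≡⟨ e+len≡m ⟩
    m                              ≡⟨ m∸n+n≡m (nextMax< bs rl) ⟨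
    c + suc R                      ≡⟨ +-suc c R ⟩
    suc (c + R)                    ∎)
    where open ≡-Reasoning
  c≤a = proj₁ (+-≤-cancel a+L≡c+R L≤R)
  a∸c+L≡R = proj₂ (+-≤-cancel a+L≡c+R L≤R)

firstAscent-max∷ : ∀ m r → maxL r < m → firstAscent (m ∷ r) ≡ suc (firstAscent r)
firstAscent-max∷ m []      _   = refl
firstAscent-max∷ m (y ∷ r) r<m rewrite ≮⇒<ᵇ≡false (<⇒≯ (≤-<-trans (m≤m⊔n y (maxL r)) r<m)) = refl

firstAscent-descending : ∀ x w m r → Descending (x ∷ w) → All (_< m) (x ∷ w) →
                         firstAscent (x ∷ w ++ m ∷ r) ≡ suc (length w)
firstAscent-descending x []      m r _                  (x<m ∷ _) rewrite <⇒<ᵇ≡true x<m = refl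
firstAscent-descending x (y ∷ w) m r ((y<x ∷ _) ∷ desc) (_ ∷ w<m) rewrite ≮⇒<ᵇ≡false (<⇒≯ y<x) =
  cong suc (firstAscent-descending y w m r desc w<m)

-- Entries smaller than m and to its left must decrease, or two of them would form a 123 with m.
Avoids123⇒Descending : ∀ w {m r} → Unique (w ++ m ∷ r) → All (_< m) w → Avoids123 (w ++ m ∷ r) → Descending w
Avoids123⇒Descending []      _        _           _  = []
Avoids123⇒Descending (x ∷ w) {m} {r} (x≢ ∷ u) (_ ∷ w<m) av =
  All.tabulate y<x ∷ Avoids123⇒Descending w u w<m (Avoids123-++⁻ʳ [ x ] av)
  where
  y<x : ∀ {y} → y ∈ w → y < x
  y<x {y} y∈w with y <? x
  ... | yes y<x = y<x
  ... | no  y≮x = ⊥-elim (av (x , y , m , xym⊆ , x<y , All.lookup w<m y∈w))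
    where
    xym⊆ : x ∷ y ∷ m ∷ [] ⊆ x ∷ w ++ m ∷ r
    xym⊆ = refl ∷ Sublist.++⁺ (from∈ y∈w) (refl ∷ minimum r)
    x<y : x < y
    x<y = ≤∧≢⇒< (≮⇒≥ y≮x) (All.lookup x≢ (∈-++⁺ˡ y∈w))

firstAscent-shapeOf : ∀ bs → RLBlocks bs → Unique (flatten bs) → Avoids123 (flatten bs) →
                      shapeFirstAscent (shapeOf bs) ≡ firstAscent (flatten bs)
firstAscent-shapeOf []                  _               _       _  = refl
firstAscent-shapeOf (([] , m) ∷ bs)     (_ , r<m , rl)  (_ ∷ u) av =
  trans (cong suc (firstAscent-shapeOf bs rl u (Avoids123-++⁻ʳ [ m ] av))) (sym (firstAscent-max∷ m (flatten bs) r<m))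
firstAscent-shapeOf ((x ∷ w , m) ∷ bs)  (w≤m , _ , _)   u       av =
  sym (firstAscent-descending x w m (flatten bs) (Avoids123⇒Descending (x ∷ w) u w<m av) w<m)
  where
  w<m : All (_< m) (x ∷ w)
  w<m = All.zipWith (λ (y≤m , y≢m) → ≤∧≢⇒< y≤m y≢m) (w≤m , Unique-++-∷⇒≢ (x ∷ w) u)

-- The 123-avoiding permutation of a shape

shapeMaxima : Shape → List ℕ
shapeMaxima []            = []
shapeMaxima ((ℓ , c) ∷ S) = suc (c + shapeHeight S) ∷ shapeMaxima S

-- t + c, …, t + 1
valuesAbove : ℕ → ℕ → List ℕ
valuesAbove t = applyDownFrom (λ i → suc (i + t))

shapeNonMaxima : Shape → List ℕ
shapeNonMaxima []            = []
shapeNonMaxima ((ℓ , c) ∷ S) = valuesAbove (shapeHeight S) c ++ shapeNonMaxima S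

shapeBlocks : Shape → List ℕ → List (List ℕ × ℕ)
shapeBlocks []            ws = []
shapeBlocks ((ℓ , c) ∷ S) ws = (take ℓ ws , suc (c + shapeHeight S)) ∷ shapeBlocks S (drop ℓ ws)

Fills : Shape → List ℕ → Set
Fills []            ws = ws ≡ []
Fills ((ℓ , c) ∷ S) ws = All (_< suc (c + shapeHeight S)) ws × ℓ ≤ length ws × Fills S (drop ℓ ws)

shapePermutation : Shape → List ℕ
shapePermutation S = flatten (shapeBlocks S (shapeNonMaxima S))

shapeMaxima≤ : ∀ S → All (_≤ shapeHeight S) (shapeMaxima S)
shapeMaxima≤ []            = []
shapeMaxima≤ ((ℓ , c) ∷ S) = ≤-refl ∷ All.map (λ x≤ → ≤-trans x≤ (m≤n+m _ (suc c))) (shapeMaxima≤ S)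

valuesAbove-bounds : ∀ t c → All (λ x → t < x × x ≤ c + t) (valuesAbove t c)
valuesAbove-bounds t c = All.applyDownFrom⁺₁ _ c (λ i<c → s≤s (m≤n+m t _) , +-monoˡ-≤ t i<c)

shapeNonMaxima≤ : ∀ S → All (_≤ shapeHeight S) (shapeNonMaxima S)
shapeNonMaxima≤ []            = []
shapeNonMaxima≤ ((ℓ , c) ∷ S) =
  All.++⁺ (All.map (λ (_ , x≤) → m≤n⇒m≤1+n x≤) (valuesAbove-bounds (shapeHeight S) c))
          (All.map (λ x≤ → ≤-trans x≤ (m≤n+m _ (suc c))) (shapeNonMaxima≤ S))

shapeMaxima-descending : ∀ S → Descending (shapeMaxima S)
shapeMaxima-descending []            = []
shapeMaxima-descending ((ℓ , c) ∷ S) =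
  All.map (λ x≤ → s≤s (≤-trans x≤ (m≤n+m _ c))) (shapeMaxima≤ S) ∷ shapeMaxima-descending S

shapeNonMaxima-descending : ∀ S → Descending (shapeNonMaxima S)
shapeNonMaxima-descending []            = []
shapeNonMaxima-descending ((ℓ , c) ∷ S) =
  AllPairs.++⁺ (AllPairs.applyDownFrom⁺₁ _ c (λ j<i _ → s≤s (+-monoˡ-≤ (shapeHeight S) j<i)))
               (shapeNonMaxima-descending S)
               (All.map (λ (h< , _) → All.map (λ x≤ → ≤-<-trans x≤ h<) (shapeNonMaxima≤ S))
                        (valuesAbove-bounds (shapeHeight S) c))

applyDownFrom-suc-++ : ∀ c t → applyDownFrom suc (c + t) ≡ valuesAbove t c ++ applyDownFrom suc t
applyDownFrom-suc-++ zero    t = refl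
applyDownFrom-suc-++ (suc c) t = cong (suc (c + t) ∷_) (applyDownFrom-suc-++ c t)

applyDownFrom-suc↭oneTo : ∀ n → applyDownFrom suc n ↭ oneTo n
applyDownFrom-suc↭oneTo n = ↭-trans (↭-reflexive reversed) (↭-reverse (oneTo n))
  where
  reversed : applyDownFrom suc n ≡ reverse (oneTo n)
  reversed = trans (sym (map-downFrom suc n)) (trans (cong (map suc) (sym (reverse-upTo n))) (reverse-map suc (upTo n)))

shapeMaxima++shapeNonMaxima↭ : ∀ S → shapeMaxima S ++ shapeNonMaxima S ↭ applyDownFrom suc (shapeHeight S)
shapeMaxima++shapeNonMaxima↭ []            = ↭-reflexive refl
shapeMaxima++shapeNonMaxima↭ ((ℓ , c) ∷ S) = prep (suc (c + h)) (begin
  shapeMaxima S ++ V ++ shapeNonMaxima S  ↭⟨ shifts (shapeMaxima S) V ⟩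
  V ++ shapeMaxima S ++ shapeNonMaxima S  ↭⟨ ++⁺ˡ V (shapeMaxima++shapeNonMaxima↭ S) ⟩
  V ++ applyDownFrom suc h                ≡⟨ applyDownFrom-suc-++ c h ⟨
  applyDownFrom suc (c + h)               ∎)
  where
  open PermutationReasoning
  h = shapeHeight S
  V = valuesAbove h c

interleave-prefixʳ : ∀ u {l r xs : List ℕ} → Interleaving l r xs → Interleaving l (u ++ r) (u ++ xs)
interleave-prefixʳ []      i = i
interleave-prefixʳ (x ∷ u) i = consʳ (interleave-prefixʳ u i)

shapeBlocks-interleaving : ∀ S ws → Fills S ws → Interleaving (shapeMaxima S) ws (flatten (shapeBlocks S ws))
shapeBlocks-interleaving []            ws refl            = []
shapeBlocks-interleaving ((ℓ , c) ∷ S) ws (_ , _ , fills) =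
  subst (λ v → Interleaving (shapeMaxima ((ℓ , c) ∷ S)) v (flatten (shapeBlocks ((ℓ , c) ∷ S) ws)))
        (take++drop≡id ℓ ws)
        (interleave-prefixʳ (take ℓ ws) (consˡ (shapeBlocks-interleaving S (drop ℓ ws) fills)))

shapeBlocks-RLBlocks : ∀ S ws → Fills S ws → RLBlocks (shapeBlocks S ws)
shapeBlocks-RLBlocks []            ws _                    = _
shapeBlocks-RLBlocks ((ℓ , c) ∷ S) ws (ws<m , _ , fills) =
  All.take⁺ ℓ (All.map <⇒≤ ws<m) , maxL< (s≤s z≤n) rest<m , shapeBlocks-RLBlocks S (drop ℓ ws) fills
  where
  rest<m : All (_< suc (c + shapeHeight S)) (flatten (shapeBlocks S (drop ℓ ws)))
  rest<m = All-resp-↭ (↭-sym (toPermutation (shapeBlocks-interleaving S (drop ℓ ws) fills)))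
             (All.++⁺ (All.map (λ x≤ → s≤s (≤-trans x≤ (m≤n+m _ c))) (shapeMaxima≤ S)) (All.drop⁺ ℓ ws<m))

nextMax-shapeBlocks : ∀ S ws → nextMax (shapeBlocks S ws) ≡ shapeHeight S
nextMax-shapeBlocks []      ws = refl
nextMax-shapeBlocks (_ ∷ _) ws = refl

shapeOf-shapeBlocks : ∀ S ws → Fills S ws → shapeOf (shapeBlocks S ws) ≡ S
shapeOf-shapeBlocks []            ws _               = refl
shapeOf-shapeBlocks ((ℓ , c) ∷ S) ws (_ , ℓ≤ , fills) =
  cong₂ _∷_ (cong₂ _,_ (trans (length-take ℓ ws) (m≤n⇒m⊓n≡m ℓ≤)) c≡)
            (shapeOf-shapeBlocks S (drop ℓ ws) fills)
  where
  c≡ : suc (c + shapeHeight S) ∸ suc (nextMax (shapeBlocks S (drop ℓ ws))) ≡ c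
  c≡ = trans (cong (λ h → c + shapeHeight S ∸ h) (nextMax-shapeBlocks S (drop ℓ ws))) (m+n∸n≡m c (shapeHeight S))

shapeWidth : Shape → ℕ
shapeWidth []            = 0
shapeWidth ((ℓ , c) ∷ S) = ℓ + shapeWidth S

length-shapeNonMaxima : ∀ e S → DyckShape e S → length (shapeNonMaxima S) ≡ e + shapeWidth S
length-shapeNonMaxima e []            e≡0         = sym (trans (+-identityʳ e) e≡0)
length-shapeNonMaxima e ((ℓ , c) ∷ S) (c≤ , dyck) = begin
  length (V ++ shapeNonMaxima S)               ≡⟨ length-++ V ⟩
  length V + length (shapeNonMaxima S)         ≡⟨ cong₂ _+_ (length-applyDownFrom _ c) (length-shapeNonMaxima _ S dyck) ⟩
  c + ((e + ℓ ∸ c) + shapeWidth S)             ≡⟨ +-assoc c _ _ ⟨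
  (c + (e + ℓ ∸ c)) + shapeWidth S             ≡⟨ cong (_+ shapeWidth S) (m+[n∸m]≡n c≤) ⟩
  (e + ℓ) + shapeWidth S                       ≡⟨ +-assoc e ℓ _ ⟩
  e + (ℓ + shapeWidth S)                       ∎
  where
  open ≡-Reasoning
  V = valuesAbove (shapeHeight S) c

drop-++ : ∀ (xs : List ℕ) k ys → drop (length xs + k) (xs ++ ys) ≡ drop k ys
drop-++ []       k ys = refl
drop-++ (x ∷ xs) k ys = drop-++ xs k ys

-- With slack e, the first e values of shapeNonMaxima S are used by the words to the left.
Fills-shapeNonMaxima : ∀ e S → DyckShape e S → Fills S (drop e (shapeNonMaxima S))
Fills-shapeNonMaxima e []            _           = drop-[] e
Fills-shapeNonMaxima e ((ℓ , c) ∷ S) (c≤ , dyck) =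
  W<m , ℓ≤ , subst (Fills S) (sym rest≡) (Fills-shapeNonMaxima _ S dyck)
  where
  h = shapeHeight S
  V = valuesAbove h c
  W = V ++ shapeNonMaxima S
  W<m : All (_< suc (c + h)) (drop e W)
  W<m = All.drop⁺ e (All.++⁺ (All.map (λ (_ , x≤) → s≤s x≤) (valuesAbove-bounds h c))
                             (All.map (λ x≤ → s≤s (≤-trans x≤ (m≤n+m h c))) (shapeNonMaxima≤ S)))
  ℓ≤ : ℓ ≤ length (drop e W)
  ℓ≤ = subst (ℓ ≤_) (sym length≡) (m≤m+n ℓ (shapeWidth S))
    where
    length≡ : length (drop e W) ≡ ℓ + shapeWidth S
    length≡ = trans (length-drop e W)
                (trans (cong (_∸ e) (length-shapeNonMaxima e ((ℓ , c) ∷ S) (c≤ , dyck))) (m+n∸m≡n e _))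
  rest≡ : drop ℓ (drop e W) ≡ drop (e + ℓ ∸ c) (shapeNonMaxima S)
  rest≡ = begin
    drop ℓ (drop e W)                    ≡⟨ drop-drop e ℓ W ⟩
    drop (e + ℓ) W                       ≡⟨ cong (λ k → drop k W) (m+[n∸m]≡n c≤) ⟨
    drop (c + (e + ℓ ∸ c)) W             ≡⟨ cong (λ k → drop (k + (e + ℓ ∸ c)) W) (length-applyDownFrom _ c) ⟨
    drop (length V + (e + ℓ ∸ c)) W      ≡⟨ drop-++ V _ _ ⟩
    drop (e + ℓ ∸ c) (shapeNonMaxima S)  ∎
    where open ≡-Reasoning

Interleaving-⊆ : ∀ {l r xs s : List ℕ} → Interleaving l r xs → s ⊆ xs →
                 Σ (List ℕ) λ s₁ → Σ (List ℕ) λ s₂ → Interleaving s₁ s₂ s × s₁ ⊆ l × s₂ ⊆ r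
Interleaving-⊆ []          []           = [] , [] , [] , [] , []
Interleaving-⊆ (consˡ i)   (_ ∷ʳ sub) with Interleaving-⊆ i sub
... | s₁ , s₂ , i′ , s₁⊆ , s₂⊆ = s₁ , s₂ , i′ , _ ∷ʳ s₁⊆ , s₂⊆
Interleaving-⊆ (consˡ i)   (refl ∷ sub) with Interleaving-⊆ i sub
... | s₁ , s₂ , i′ , s₁⊆ , s₂⊆ = _ ∷ s₁ , s₂ , consˡ i′ , refl ∷ s₁⊆ , s₂⊆
Interleaving-⊆ (consʳ i)   (_ ∷ʳ sub) with Interleaving-⊆ i sub
... | s₁ , s₂ , i′ , s₁⊆ , s₂⊆ = s₁ , s₂ , i′ , s₁⊆ , _ ∷ʳ s₂⊆
Interleaving-⊆ (consʳ i)   (refl ∷ sub) with Interleaving-⊆ i sub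
... | s₁ , s₂ , i′ , s₁⊆ , s₂⊆ = s₁ , _ ∷ s₂ , consʳ i′ , s₁⊆ , refl ∷ s₂⊆

Descending-⊆ : ∀ {s l} → s ⊆ l → Descending l → Descending s
Descending-⊆ []           []        = []
Descending-⊆ (_ ∷ʳ sub)   (_ ∷ d)   = Descending-⊆ sub d
Descending-⊆ (refl ∷ sub) (x> ∷ d)  = Sublist.All-resp-⊆ sub x> ∷ Descending-⊆ sub d

-- Two of the three entries go to the same side, where they would have to decrease.
interleaving-no-increasing-triple : ∀ {a b c s₁ s₂} → Interleaving s₁ s₂ (a ∷ b ∷ c ∷ []) →
  Descending s₁ → Descending s₂ → a < b → b < c → ⊥
interleaving-no-increasing-triple (consˡ (consˡ _))         ((b<a ∷ _) ∷ _) _               a<b _   = <-asym a<b b<a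
interleaving-no-increasing-triple (consʳ (consʳ _))         _               ((b<a ∷ _) ∷ _) a<b _   = <-asym a<b b<a
interleaving-no-increasing-triple (consˡ (consʳ (consˡ _))) ((c<a ∷ _) ∷ _) _               a<b b<c = <-asym (<-trans a<b b<c) c<a
interleaving-no-increasing-triple (consˡ (consʳ (consʳ _))) _               ((c<b ∷ _) ∷ _) _   b<c = <-asym b<c c<b
interleaving-no-increasing-triple (consʳ (consˡ (consˡ _))) ((c<b ∷ _) ∷ _) _               _   b<c = <-asym b<c c<b
interleaving-no-increasing-triple (consʳ (consˡ (consʳ _))) _               ((c<a ∷ _) ∷ _) a<b b<c = <-asym (<-trans a<b b<c) c<a

interleaving-avoids123 : ∀ {l r π} → Interleaving l r π → Descending l → Descending r → Avoids123 π
interleaving-avoids123 i dₗ dᵣ (a , b , c , abc⊆ , a<b , b<c) with Interleaving-⊆ i abc⊆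
... | s₁ , s₂ , i′ , s₁⊆ , s₂⊆ =
  interleaving-no-increasing-triple i′ (Descending-⊆ s₁⊆ dₗ) (Descending-⊆ s₂⊆ dᵣ) a<b b<c

IsPerm⇒Unique : ∀ {n π} → IsPerm n π → Unique π
IsPerm⇒Unique {n} π↭ = Unique-resp-↭ (↭⇒↭ₛ (↭-sym π↭)) (Unique.map⁺ suc-injective (Unique.upTo⁺ n))

IsPerm⇒bounds : ∀ {n π} → IsPerm n π → All (λ x → 0 < x × x ≤ n) π
IsPerm⇒bounds π↭ = All.tabulate λ x∈π → bounds (∈-resp-↭ π↭ x∈π)
  where
  bounds : ∀ {n x} → x ∈ oneTo n → 0 < x × x ≤ n
  bounds x∈ with ∈-map⁻ suc x∈
  ... | i , i∈ , refl = s≤s z≤n , ∈-upTo⁻ i∈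

IsPerm⇒length : ∀ {n π} → IsPerm n π → length π ≡ n
IsPerm⇒length {n} π↭ = trans (↭-length π↭) (trans (length-map suc (upTo n)) (length-upTo n))

IsPerm⇒maxL : ∀ {n π} → IsPerm n π → maxL π ≡ n
IsPerm⇒maxL {zero}  π↭ = ≤-antisym (maxL≤ (All.map proj₂ (IsPerm⇒bounds π↭))) z≤n
IsPerm⇒maxL {suc n} π↭ = ≤-antisym (maxL≤ (All.map proj₂ (IsPerm⇒bounds π↭)))
  (∈⇒≤maxL (∈-resp-↭ (↭-sym π↭) (∈-map⁺ suc (∈-upTo⁺ (n<1+n n)))))

K-analysis : ∀ {n} π → IsPerm n π → Avoids123 π → let S = shapeOf (blocks π) in
  K π ≡ shapePath S × DyckShape 0 S × shapeHeight S ≡ n × shapeFirstAscent S ≡ firstAscent π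
K-analysis {n} π π↭ avoids = path , dyck , height , fa
  where
  bs = blocks π
  positive = All.map proj₁ (IsPerm⇒bounds π↭)
  decomposition = blocks-decomposition π positive
  flat = proj₁ decomposition
  rl = proj₂ decomposition
  unique : Unique (flatten bs)
  unique = subst Unique (sym flat) (IsPerm⇒Unique π↭)
  path = pathOfBlocks-shapeOf bs rl
  nextMax≡n : nextMax bs ≡ n
  nextMax≡n = trans (nextMax≡maxL bs rl) (trans (cong maxL flat) (IsPerm⇒maxL π↭))
  height = trans (shapeHeight-shapeOf bs rl) nextMax≡n
  dyck = shapeOf-Dyck 0 bs rl unique (subst (All (0 <_)) (sym flat) positive)
           (trans (cong length flat) (trans (IsPerm⇒length π↭) (sym nextMax≡n)))
  fa = trans (firstAscent-shapeOf bs rl unique (subst Avoids123 (sym flat) avoids)) (cong firstAscent flat)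

shapePermutation-properties : ∀ S → DyckShape 0 S → let π = shapePermutation S in
  IsPerm (shapeHeight S) π × Avoids123 π × firstAscent π ≡ shapeFirstAscent S × K π ≡ shapePath S
shapePermutation-properties S dyck = perm , avoids , fa , path
  where
  ws = shapeNonMaxima S
  bs = shapeBlocks S ws
  fills = Fills-shapeNonMaxima 0 S dyck
  interleaving = shapeBlocks-interleaving S ws fills
  rl = shapeBlocks-RLBlocks S ws fills
  perm : IsPerm (shapeHeight S) (flatten bs)
  perm = ↭-trans (toPermutation interleaving)
           (↭-trans (shapeMaxima++shapeNonMaxima↭ S) (applyDownFrom-suc↭oneTo (shapeHeight S)))
  avoids = interleaving-avoids123 interleaving (shapeMaxima-descending S) (shapeNonMaxima-descending S)
  fa = trans (sym (firstAscent-shapeOf bs rl (IsPerm⇒Unique perm) avoids))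
             (cong shapeFirstAscent (shapeOf-shapeBlocks S ws fills))
  path = begin
    pathOfBlocks (blocks (flatten bs)) ≡⟨ cong pathOfBlocks (blocks-flatten bs rl) ⟩
    pathOfBlocks bs                     ≡⟨ pathOfBlocks-shapeOf bs rl ⟩
    shapePath (shapeOf bs)              ≡⟨ cong shapePath (shapeOf-shapeBlocks S ws fills) ⟩
    shapePath S                         ∎
    where open ≡-Reasoning

Bij⇒HasCard : ∀ {A B : Set} {P : A → Set} {Q : B → Set} {c} → Bij P Q → HasCard Q c → HasCard P c
Bij⇒HasCard {P = P} {Q} (f , g , fP , gQ , gf , fg) (xs , unique , ∈xs⇔ , length≡) =
  map g xs , unique′ , (λ a → mk⇔ (to a) (from a)) , trans (length-map g xs) length≡
  where
  unique′ : Unique (map g xs)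
  unique′ = Unique.map⁻ {f = f} (subst Unique (sym (trans (sym (map-∘ xs)) fg-id)) unique)
    where
    fg-id = map-id-local (All.tabulate λ {b} b∈ → fg b (Equivalence.to (∈xs⇔ b) b∈))
  to : ∀ a → a ∈ map g xs → P a
  to a a∈ with ∈-map⁻ g a∈
  ... | b , b∈ , refl = gQ b (Equivalence.to (∈xs⇔ b) b∈)
  from : ∀ a → P a → a ∈ map g xs
  from a pa = subst (_∈ map g xs) (gf a pa) (∈-map⁺ g (Equivalence.from (∈xs⇔ (f a)) (fP a pa)))

module _ (d r : ℕ) where

  private
    n k : ℕ
    n = suc (d + r)
    k = suc d

  TargetPaths⇒BallotPath : ∀ q → TargetPaths n k q → BallotPath r d q
  TargetPaths⇒BallotPath q (below , end) =
    WeaklyBelow⇒Ballot 0 d q below , +-cancelˡ-≡ d _ _ (cong proj₁ end′) , cong proj₂ end′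
    where end′ = trans (sym (endPoint≡ d 0 q)) end

  BallotPath⇒TargetPaths : ∀ q → BallotPath r d q → TargetPaths n k q
  BallotPath⇒TargetPaths q (ballot , #Eq , #Nq) =
    Ballot⇒WeaklyBelow 0 d q ballot , trans (endPoint≡ d 0 q) (cong₂ _,_ (cong (d +_) #Eq) #Nq)

  KImage⇒toDyck : ∀ {p} → KImage n k p → Σ (List Step) λ q → BallotPath r d q × p ≡ toDyck d q
  KImage⇒toDyck (π , π↭ , avoids , fa , refl) with K-analysis π π↭ avoids
  ... | path , dyck , height , faS with shape-toDyck d (shapeOf (blocks π)) dyck (trans faS fa)
  ...   | q , pathq , ballot = q , (ballot , #Eq , #Nq) , trans path pathq
    where
    S = shapeOf (blocks π)
    #N≡ : #N (toDyck d q) ≡ n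
    #N≡ = trans (cong #N (sym pathq)) (trans (#N-shapePath S) height)
    #Nq = cong pred (trans (sym (#N-toDyck d q ballot)) #N≡)
    #Eq = +-cancelˡ-≡ k _ _ (trans (sym (#E-toDyck d q ballot))
            (trans (cong #E (sym pathq)) (trans (proj₂ (DyckShape⇒Dyck 0 S dyck)) (trans (cong #N pathq) #N≡))))

  BallotPath⇒KImage : ∀ {q} → BallotPath r d q → KImage n k (toDyck d q)
  BallotPath⇒KImage {q} (ballot , #Eq , #Nq) with toDyck-shape d q (ballot , trans (cong (d +_) #Eq) (sym #Nq))
  ... | S , path , dyck , faS with shapePermutation-properties S dyck
  ...   | π↭ , avoids , fa , Kπ =
    shapePermutation S , subst (λ m → IsPerm m (shapePermutation S)) height π↭ , avoids , trans fa faS , trans Kπ path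
    where
    height : shapeHeight S ≡ n
    height = trans (sym (#N-shapePath S)) (trans (cong #N path) (trans (#N-toDyck d q ballot) (cong suc #Nq)))

  KImage↔TargetPaths : Bij (KImage n k) (TargetPaths n k)
  KImage↔TargetPaths = fromDyck d , toDyck d , toTarget , toKImage , toDyck∘fromDyck , fromDyck∘toDyck
    where
    fromDyck∘toDyck : ∀ q → TargetPaths n k q → fromDyck d (toDyck d q) ≡ q
    fromDyck∘toDyck q t = fromDyck-toDyck d q (proj₁ (TargetPaths⇒BallotPath q t))
    toKImage : ∀ q → TargetPaths n k q → KImage n k (toDyck d q)
    toKImage q t = BallotPath⇒KImage {q} (TargetPaths⇒BallotPath q t)
    toTarget : ∀ p → KImage n k p → TargetPaths n k (fromDyck d p)
    toTarget p kp with KImage⇒toDyck kp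
    ... | q , bq , refl = subst (TargetPaths n k) (sym (fromDyck-toDyck d q (proj₁ bq))) (BallotPath⇒TargetPaths q bq)
    toDyck∘fromDyck : ∀ p → KImage n k p → toDyck d (fromDyck d p) ≡ p
    toDyck∘fromDyck p kp with KImage⇒toDyck kp
    ... | q , bq , refl = cong (toDyck d) (fromDyck-toDyck d q (proj₁ bq))

  ballotNumber-count : (n + n ∸ k) * ballotNumber r d ≡ k * ((n + n ∸ k) C n)
  ballotNumber-count = begin
    (n + n ∸ k) * ballotNumber r d            ≡⟨ cong (_* ballotNumber r d) 2n∸k≡ ⟩
    suc (r + r + d) * ballotNumber r d        ≡⟨ ballotNumber-closedForm r d ⟩
    k * (suc (r + r + d) C suc (r + d))       ≡⟨ cong₂ (λ a b → k * (a C suc b)) (sym 2n∸k≡) (+-comm r d) ⟩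
    k * ((n + n ∸ k) C n)                     ∎
    where
    open ≡-Reasoning
    2n∸k≡ : n + n ∸ k ≡ suc (r + r + d)
    2n∸k≡ = trans (cong (_∸ d) (+-assoc d r n)) (trans (m+n∸m≡n d (r + n)) (rearrange r d))
      where
      rearrange : ∀ r d → r + suc (d + r) ≡ suc (r + r + d)
      rearrange = solve-∀

  TargetPaths-card : HasCard (TargetPaths n k) (ballotNumber r d)
  TargetPaths-card = ballotPaths r d , ballotPaths-unique r d ,
    (λ q → mk⇔ (BallotPath⇒TargetPaths q ∘ ∈-ballotPaths⁻ r d) (∈-ballotPaths⁺ r d q ∘ TargetPaths⇒BallotPath q)) ,
    length-ballotPaths r d

theorem3p3 : (n k : ℕ) → 1 ≤ n → 1 ≤ k → k ≤ n →
    Bij (KImage n k) (TargetPaths n k) ×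
    Σ ℕ (λ c → HasCard (KImage n k) c × HasCard (TargetPaths n k) c ×
               (n + n ∸ k) * c ≡ k * ((n + n ∸ k) C n))
theorem3p3 (suc _) (suc d) _ _ (s≤s d≤n) with m≤n⇒∃[o]m+o≡n d≤n
... | r , refl =
  KImage↔TargetPaths d r , ballotNumber r d ,
  Bij⇒HasCard (KImage↔TargetPaths d r) (TargetPaths-card d r) , TargetPaths-card d r , ballotNumber-count d r
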